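{- Let $n \ge 2$ be an integer and let $G = G_{2^n+1,2}$. For every $X \subseteq V(G)$, we have $\chi(G[X]) \le n$ if and only if there exists an $X$-good sequence.
   Context: For an integer $N \ge 5$, the shift graph $G_{N,2}$ has as vertices the ordered pairs $(x,y)$ of integers with $1 \le x < y \le N$, and two vertices $(x,y)$ and $(y,z)$ are adjacent whenever $x<y<z$ (these are the only edges). $G[X]$ denotes the subgraph induced by $X$. Let $S(n)$ be the set of all subsets of $[1,n]=\{1,\dots,n\}$. For $X \subseteq V(G)$, a sequence $a=(a_1,\dots,a_{2^n+1})$ of elements of $S(n)$ is called $X$-good if for all $i,j$ with $1 \le i < j \le 2^n+1$ and $(i,j) \in X$, we have $a_i \not\subseteq a_j$. -}

module Defs where

open import Data.Nat using (ℕ; _+_; _^_)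
open import Data.Fin using (Fin; _<_)
open import Data.Fin.Subset using (Subset; _⊆_)
open import Data.Bool using (Bool; true)
open import Data.Product using (∃)
open import Relation.Nullary using (¬_)
open import Relation.Binary.PropositionalEquality using (_≡_; _≢_)

-- Number of "points" of the shift graph: N = 2^n + 1.
-- The points 1..N are represented (0-based) by Fin N.
N : ℕ → ℕ
N n = 2 ^ n + 1

-- A vertex of the shift graph G_{M,2} is a pair (x , y) with x < y.
-- A set X ⊆ V(G_{M,2}) is given by its characteristic function on pairs;
-- its values on pairs (x , y) with ¬ x < y are irrelevant (they are not
-- vertices and every use below is guarded by x < y).
VertexSet : ℕ → Set
VertexSet M = Fin M → Fin M → Bool

-- Edges of G_{M,2}: (x,y) ~ (y,z) whenever x < y < z.
ProperColouring : ∀ {M} → VertexSet M → (k : ℕ) → (Fin M → Fin M → Fin k) → Set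
ProperColouring {M} X k c =
  ∀ (x y z : Fin M) → x < y → y < z →
    X x y ≡ true → X y z ≡ true → c x y ≢ c y z

ChromaticAtMost : ∀ {M} → VertexSet M → ℕ → Set
ChromaticAtMost {M} X k = ∃ λ (c : Fin M → Fin M → Fin k) → ProperColouring X k c

Good : (n : ℕ) → VertexSet (N n) → (Fin (N n) → Subset n) → Set
Good n X a = ∀ (i j : Fin (N n)) → i < j → X i j ≡ true → ¬ (a i ⊆ a j)

{-# OPTIONS --safe #-}
-- A colouring c with k colours and a sequence a of subsets of [1,k] determine
-- each other: a_i is the set of colours c(i,l) of the vertices (i,l) ∈ X,
-- and c(i,j) is a colour in a_i ∖ a_j. Two adjacent vertices (x,y) and (y,z)
-- get different colours because c(x,y) ∉ a_y while c(y,z) ∈ a_y. Neither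
-- direction uses that there are 2^n + 1 points, and n ≥ 1 suffices.
module Submission where

open import Defs
open import Level using (0ℓ)
open import Data.Nat using (ℕ; zero; suc; _≥_)
open import Data.Fin using (Fin; zero; _<_)
open import Data.Fin.Properties using (any?; _<?_) renaming (_≟_ to _≟ᶠ_)
open import Data.Fin.Subset using (Subset; _∈_; _∉_; _⊆_; _⊈_)
open import Data.Fin.Subset.Properties using (_∈?_)
open import Data.Bool using (true)
open import Data.Bool.Properties using () renaming (_≟_ to _≟ᵇ_)
open import Data.Product using (∃; _×_; _,_; proj₁; proj₂)
open import Data.Vec using (tabulate)
open import Data.Vec.Properties using (lookup∘tabulate; []=⇒lookup; lookup⇒[]=)
open import Data.Empty using (⊥-elim)
open import Relation.Nullary using (Dec; yes; no; does; ¬?; contradiction)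
open import Relation.Nullary.Decidable using (_×-dec_; dec-true; decidable-stable)
open import Relation.Unary using (Pred; Decidable)
open import Relation.Binary.PropositionalEquality using (_≡_; refl; sym; trans; subst)
open import Function.Bundles using (_⇔_; mk⇔)

private
  variable
    M k : ℕ

does⇒ : ∀ {A : Set} (a? : Dec A) → does a? ≡ true → A
does⇒ (yes a) _ = a

subsetOf : {P : Pred (Fin k) 0ℓ} → Decidable P → Subset k
subsetOf P? = tabulate (λ x → does (P? x))

module _ {P : Pred (Fin k) 0ℓ} (P? : Decidable P) where

  ∈-subsetOf⁺ : ∀ {x} → P x → x ∈ subsetOf P?
  ∈-subsetOf⁺ {x} px =
    lookup⇒[]= x (subsetOf P?) (trans (lookup∘tabulate _ x) (dec-true (P? x) px))

  ∈-subsetOf⁻ : ∀ {x} → x ∈ subsetOf P? → P x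
  ∈-subsetOf⁻ {x} x∈ = does⇒ (P? x) (trans (sym (lookup∘tabulate _ x)) ([]=⇒lookup x∈))

⊈⇒∃∈∉ : {p q : Subset k} → p ⊈ q → ∃ λ x → x ∈ p × x ∉ q
⊈⇒∃∈∉ {p = p} {q} p⊈q with any? (λ x → x ∈? p ×-dec ¬? (x ∈? q))
... | yes x∈p∖q = x∈p∖q
... | no ∄x∈p∖q = ⊥-elim (p⊈q p⊆q)
  where
  p⊆q : p ⊆ q
  p⊆q {x} x∈p = decidable-stable (x ∈? q) (λ x∉q → ∄x∈p∖q (x , x∈p , x∉q))

IsGood : VertexSet M → (Fin M → Subset k) → Set
IsGood {M} X a = ∀ (i j : Fin M) → i < j → X i j ≡ true → a i ⊈ a j

vertex? : (X : VertexSet M) (i j : Fin M) → Dec (i < j × X i j ≡ true)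
vertex? X i j = i <? j ×-dec X i j ≟ᵇ true

module _ {X : VertexSet M} (c : Fin M → Fin M → Fin k) where

  OutColour : Fin M → Pred (Fin k) 0ℓ
  OutColour i col = ∃ λ l → (i < l × X i l ≡ true) × c i l ≡ col

  outColour? : ∀ i → Decidable (OutColour i)
  outColour? i col = any? (λ l → vertex? X i l ×-dec c i l ≟ᶠ col)

  outColours : Fin M → Subset k
  outColours i = subsetOf (outColour? i)

  ∈-outColours⁺ : ∀ {i l} → i < l → X i l ≡ true → c i l ∈ outColours i
  ∈-outColours⁺ {i} {l} i<l il∈X = ∈-subsetOf⁺ (outColour? i) (l , (i<l , il∈X) , refl)

  ∈-outColours⁻ : ∀ {i col} → col ∈ outColours i → OutColour i col
  ∈-outColours⁻ {i} = ∈-subsetOf⁻ (outColour? i)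

  outColours-good : ProperColouring X k c → IsGood X outColours
  outColours-good proper i j i<j ij∈X a[i]⊆a[j] =
    let l , (j<l , jl∈X) , c[j,l]≡c[i,j] = ∈-outColours⁻ (a[i]⊆a[j] (∈-outColours⁺ i<j ij∈X))
    in  proper i j l i<j j<l ij∈X jl∈X (sym c[j,l]≡c[i,j])

module _ {X : VertexSet M} {a : Fin M → Subset (suc k)} (good : IsGood X a) where

  separatingColour : ∀ i j → Dec (i < j × X i j ≡ true) → Fin (suc k)
  separatingColour i j (yes (i<j , ij∈X)) = proj₁ (⊈⇒∃∈∉ (good i j i<j ij∈X))
  separatingColour i j (no _)             = zero

  separatingColouring : Fin M → Fin M → Fin (suc k)
  separatingColouring i j = separatingColour i j (vertex? X i j)

  separatingColouring-separates : ∀ {i j} → i < j → X i j ≡ true →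
    separatingColouring i j ∈ a i × separatingColouring i j ∉ a j
  separatingColouring-separates {i} {j} i<j ij∈X with vertex? X i j
  ... | yes (i<j′ , ij∈X′) = proj₂ (⊈⇒∃∈∉ (good i j i<j′ ij∈X′))
  ... | no ij∉X            = contradiction (i<j , ij∈X) ij∉X

  separatingColouring-proper : ProperColouring X (suc k) separatingColouring
  separatingColouring-proper x y z x<y y<z xy∈X yz∈X c[x,y]≡c[y,z] =
    proj₂ (separatingColouring-separates x<y xy∈X)
      (subst (_∈ a y) (sym c[x,y]≡c[y,z]) (proj₁ (separatingColouring-separates y<z yz∈X)))

colourable⇔good : (X : VertexSet M) →
  ChromaticAtMost X (suc k) ⇔ (∃ λ (a : Fin M → Subset (suc k)) → IsGood X a)
colourable⇔good X = mk⇔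
  (λ (c , proper) → outColours c , outColours-good c proper)
  (λ (a , good) → separatingColouring good , separatingColouring-proper good)

proposition2 : (n : ℕ) → n ≥ 2 → (X : VertexSet (N n)) →
    ChromaticAtMost X n ⇔ (∃ λ (a : Fin (N n) → Subset n) → Good n X a)
proposition2 zero    ()
proposition2 (suc n) _ = colourable⇔good
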